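{- Let $\mathcal{K}$ be a 2-category with a 0-cell $\mathcal{C}$, 1-cells $P,T:\mathcal{C}\to\mathcal{C}$, and 2-cells $\mu^P:P^2\Rightarrow P$, $\eta^P:I\Rightarrow P$, $\mu^T:T^2\Rightarrow T$, $\eta^T:I\Rightarrow T$, $\theta:TP\Rightarrow PT$, such that $(\mu^P,\eta^P)$ and $(\mu^T,\eta^T)$ both satisfy the monad axioms, i.e. $\mu^P\circ\mu^PP=\mu^P\circ P\mu^P$, $\mu^P\circ\eta^PP=\mu^P\circ P\eta^P=\mathrm{id}_P$, and likewise for $T$. The following are equivalent: (1) $\theta$ satisfies the distributive law axioms $$\theta\circ T\mu^P=\mu^PT\circ P\theta\circ\theta P,\qquad \theta\circ\mu^TP=P\mu^T\circ\theta T\circ T\theta,$$ $$\theta\circ T\eta^P=\eta^PT,\qquad \theta\circ\eta^TP=P\eta^T;$$ (2) $PT$ is a terminal object in the rewrite category whose objects are all strings over the alphabet $\{P,T\}$ and whose rewrite rules are $\mu^P,\mu^T,\eta^P,\eta^T,\theta$; that is, for every string $X$ over $\{P,T\}$ there exists a derivation from $X$ to $PT$, and any two derivations from $X$ to $PT$ have the same value.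
   Context: Juxtaposition of 1-cells denotes composition, $I$ is the identity 1-cell on $\mathcal{C}$, $\circ$ is vertical composition of 2-cells, and for 1-cells $A,B$ and a 2-cell $\phi:F\Rightarrow G$, $A\phi B:AFB\Rightarrow AGB$ is the whiskering of $\phi$ by the identity 2-cells of $A$ and $B$. Strings over $\{P,T\}$ (including the empty string, interpreted as $I$) are interpreted as composites of 1-cells. A reduction applies a rule $\phi:U\Rightarrow V$ (one of $\mu^P:PP\Rightarrow P$, $\eta^P:\varepsilon\Rightarrow P$, $\mu^T:TT\Rightarrow T$, $\eta^T:\varepsilon\Rightarrow T$, $\theta:TP\Rightarrow PT$, with $\varepsilon$ the empty string) to an occurrence of $U$ inside a string $AUB$, producing $AVB$, with associated 2-cell $A\phi B$. A derivation is a finite (possibly empty) sequence of reductions; its value is the vertical composite of the associated 2-cells (identity for the empty derivation). Morphisms of the rewrite category are values of derivations. -}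

module Defs where

open import Level using (Level; _⊔_) renaming (suc to lsuc)
open import Relation.Binary.Core using (Rel)
open import Relation.Binary.Structures using (IsEquivalence)
open import Relation.Binary.PropositionalEquality
  using (_≡_; refl; sym; trans; cong; subst)
open import Data.List using (List; []; _∷_; _++_)
open import Data.Product using (Σ; _×_; _,_)
open import Relation.Binary.Construct.Closure.ReflexiveTransitive
  using (Star; ε; _◅_)
open import Function.Bundles using (_⇔_)

-- Strict 2-categories.
-- 1-cells compose strictly (equations are propositional equalities of
-- 1-cells, and the 1-cells between two 0-cells form a set); 2-cells
-- carry an equivalence relation _≈_ (their equality).
-- f ⊙ g is "f after g" (juxtaposition fg).

record TwoCategory (o ℓ₁ ℓ₂ e : Level) : Set (lsuc (o ⊔ ℓ₁ ⊔ ℓ₂ ⊔ e)) where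
  infixr 9 _⊙_
  infixr 9 _∘ᵥ_
  infixr 10 _∘ₕ_
  infix 4 _≈_
  field
    Obj   : Set o
    _⇒₁_  : Obj → Obj → Set ℓ₁
    _⇒₂_  : ∀ {A B} → A ⇒₁ B → A ⇒₁ B → Set ℓ₂
    _≈_   : ∀ {A B} {f g : A ⇒₁ B} → Rel (f ⇒₂ g) e
    ≈-isEquivalence : ∀ {A B} {f g : A ⇒₁ B} → IsEquivalence (_≈_ {A} {B} {f} {g})

    id₁   : ∀ {A} → A ⇒₁ A
    _⊙_   : ∀ {A B C} → B ⇒₁ C → A ⇒₁ B → A ⇒₁ C
    ⊙-assoc     : ∀ {A B C D} {f : C ⇒₁ D} {g : B ⇒₁ C} {h : A ⇒₁ B} →
                  (f ⊙ g) ⊙ h ≡ f ⊙ (g ⊙ h)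
    ⊙-identityˡ : ∀ {A B} {f : A ⇒₁ B} → id₁ ⊙ f ≡ f
    ⊙-identityʳ : ∀ {A B} {f : A ⇒₁ B} → f ⊙ id₁ ≡ f
    ⇒₁-isSet    : ∀ {A B} {f g : A ⇒₁ B} (p q : f ≡ g) → p ≡ q

    id₂   : ∀ {A B} {f : A ⇒₁ B} → f ⇒₂ f
    _∘ᵥ_  : ∀ {A B} {f g h : A ⇒₁ B} → g ⇒₂ h → f ⇒₂ g → f ⇒₂ h
    ∘ᵥ-assoc     : ∀ {A B} {f g h k : A ⇒₁ B}
                   {α : f ⇒₂ g} {β : g ⇒₂ h} {γ : h ⇒₂ k} →
                   (γ ∘ᵥ β) ∘ᵥ α ≈ γ ∘ᵥ (β ∘ᵥ α)
    ∘ᵥ-identityˡ : ∀ {A B} {f g : A ⇒₁ B} {α : f ⇒₂ g} → id₂ ∘ᵥ α ≈ α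
    ∘ᵥ-identityʳ : ∀ {A B} {f g : A ⇒₁ B} {α : f ⇒₂ g} → α ∘ᵥ id₂ ≈ α
    ∘ᵥ-resp-≈    : ∀ {A B} {f g h : A ⇒₁ B} {β β' : g ⇒₂ h} {α α' : f ⇒₂ g} →
                   β ≈ β' → α ≈ α' → β ∘ᵥ α ≈ β' ∘ᵥ α'

    _∘ₕ_  : ∀ {A B C} {f f' : B ⇒₁ C} {g g' : A ⇒₁ B} →
            f ⇒₂ f' → g ⇒₂ g' → (f ⊙ g) ⇒₂ (f' ⊙ g')
    ∘ₕ-resp-≈    : ∀ {A B C} {f f' : B ⇒₁ C} {g g' : A ⇒₁ B}
                   {α α' : f ⇒₂ f'} {β β' : g ⇒₂ g'} →
                   α ≈ α' → β ≈ β' → α ∘ₕ β ≈ α' ∘ₕ β'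
    ∘ₕ-id        : ∀ {A B C} {f : B ⇒₁ C} {g : A ⇒₁ B} →
                   id₂ {f = f} ∘ₕ id₂ {f = g} ≈ id₂
    interchange  : ∀ {A B C} {f f' f'' : B ⇒₁ C} {g g' g'' : A ⇒₁ B}
                   {α : f ⇒₂ f'} {α' : f' ⇒₂ f''} {β : g ⇒₂ g'} {β' : g' ⇒₂ g''} →
                   (α' ∘ᵥ α) ∘ₕ (β' ∘ᵥ β) ≈ (α' ∘ₕ β') ∘ᵥ (α ∘ₕ β)

  coe : ∀ {A B} {f g : A ⇒₁ B} → f ≡ g → f ⇒₂ g
  coe {f = f} p = subst (λ g → f ⇒₂ g) p id₂

  -- strict associativity and unitality of horizontal composition
  -- (stated by transporting along the strict 1-cell equations)
  field
    ∘ₕ-assoc     : ∀ {A B C D} {f f' : C ⇒₁ D} {g g' : B ⇒₁ C} {h h' : A ⇒₁ B}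
                   {α : f ⇒₂ f'} {β : g ⇒₂ g'} {γ : h ⇒₂ h'} →
                   coe ⊙-assoc ∘ᵥ ((α ∘ₕ β) ∘ₕ γ) ≈ (α ∘ₕ (β ∘ₕ γ)) ∘ᵥ coe ⊙-assoc
    ∘ₕ-identityˡ : ∀ {A B} {f f' : A ⇒₁ B} {α : f ⇒₂ f'} →
                   coe ⊙-identityˡ ∘ᵥ (id₂ {f = id₁} ∘ₕ α) ≈ α ∘ᵥ coe ⊙-identityˡ
    ∘ₕ-identityʳ : ∀ {A B} {f f' : A ⇒₁ B} {α : f ⇒₂ f'} →
                   coe ⊙-identityʳ ∘ᵥ (α ∘ₕ id₂ {f = id₁}) ≈ α ∘ᵥ coe ⊙-identityʳ

module Setup {o ℓ₁ ℓ₂ e} (K : TwoCategory o ℓ₁ ℓ₂ e) (𝒞 : TwoCategory.Obj K) where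
  open TwoCategory K

  _▷_ : (F : 𝒞 ⇒₁ 𝒞) {G H : 𝒞 ⇒₁ 𝒞} → G ⇒₂ H → (F ⊙ G) ⇒₂ (F ⊙ H)
  F ▷ α = id₂ {f = F} ∘ₕ α

  _◁_ : {G H : 𝒞 ⇒₁ 𝒞} → G ⇒₂ H → (F : 𝒞 ⇒₁ 𝒞) → (G ⊙ F) ⇒₂ (H ⊙ F)
  α ◁ F = α ∘ₕ id₂ {f = F}

  record IsMonad (M : 𝒞 ⇒₁ 𝒞) (μ : (M ⊙ M) ⇒₂ M) (η : id₁ ⇒₂ M) : Set e where
    field
      assoc     : μ ∘ᵥ (μ ◁ M) ≈ (μ ∘ᵥ (M ▷ μ)) ∘ᵥ coe ⊙-assoc
      identityˡ : μ ∘ᵥ (η ◁ M) ≈ coe ⊙-identityˡ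
      identityʳ : μ ∘ᵥ (M ▷ η) ≈ coe ⊙-identityʳ

  module Data (P T : 𝒞 ⇒₁ 𝒞)
              (μP : (P ⊙ P) ⇒₂ P) (ηP : id₁ ⇒₂ P)
              (μT : (T ⊙ T) ⇒₂ T) (ηT : id₁ ⇒₂ T)
              (θ  : (T ⊙ P) ⇒₂ (P ⊙ T)) where

    record IsDistributiveLaw : Set e where
      field
        dist-μP : θ ∘ᵥ (T ▷ μP)
                  ≈ (μP ◁ T) ∘ᵥ coe (sym ⊙-assoc) ∘ᵥ (P ▷ θ) ∘ᵥ coe ⊙-assoc
                      ∘ᵥ (θ ◁ P) ∘ᵥ coe (sym ⊙-assoc)
        dist-μT : θ ∘ᵥ (μT ◁ P)
                  ≈ (P ▷ μT) ∘ᵥ coe ⊙-assoc ∘ᵥ (θ ◁ T) ∘ᵥ coe (sym ⊙-assoc)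
                      ∘ᵥ (T ▷ θ) ∘ᵥ coe ⊙-assoc
        dist-ηP : θ ∘ᵥ (T ▷ ηP) ≈ (ηP ◁ T) ∘ᵥ coe (trans ⊙-identityʳ (sym ⊙-identityˡ))
        dist-ηT : θ ∘ᵥ (ηT ◁ P) ≈ (P ▷ ηT) ∘ᵥ coe (trans ⊙-identityˡ (sym ⊙-identityʳ))

    data Letter : Set where
      𝐏 𝐓 : Letter

    Word : Set
    Word = List Letter

    letter : Letter → 𝒞 ⇒₁ 𝒞
    letter 𝐏 = P
    letter 𝐓 = T

    ⟦_⟧ : Word → 𝒞 ⇒₁ 𝒞
    ⟦ [] ⟧          = id₁
    ⟦ x ∷ [] ⟧      = letter x
    ⟦ x ∷ y ∷ w ⟧   = letter x ⊙ ⟦ y ∷ w ⟧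

    ⟦++⟧ : ∀ A W → ⟦ A ++ W ⟧ ≡ ⟦ A ⟧ ⊙ ⟦ W ⟧
    ⟦++⟧ [] W                 = sym ⊙-identityˡ
    ⟦++⟧ (x ∷ []) []          = sym ⊙-identityʳ
    ⟦++⟧ (x ∷ []) (y ∷ W)     = refl
    ⟦++⟧ (x ∷ y ∷ A) W        =
      trans (cong (letter x ⊙_) (⟦++⟧ (y ∷ A) W)) (sym ⊙-assoc)

    data Rule : Word → Word → Set where
      rμP : Rule (𝐏 ∷ 𝐏 ∷ []) (𝐏 ∷ [])
      rηP : Rule [] (𝐏 ∷ [])
      rμT : Rule (𝐓 ∷ 𝐓 ∷ []) (𝐓 ∷ [])
      rηT : Rule [] (𝐓 ∷ [])
      rθ  : Rule (𝐓 ∷ 𝐏 ∷ []) (𝐏 ∷ 𝐓 ∷ [])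

    rule₂ : ∀ {U V} → Rule U V → ⟦ U ⟧ ⇒₂ ⟦ V ⟧
    rule₂ rμP = μP
    rule₂ rηP = ηP
    rule₂ rμT = μT
    rule₂ rηT = ηT
    rule₂ rθ  = θ

    data Reduction : Word → Word → Set where
      reduce : ∀ (A : Word) {U V} (r : Rule U V) (B : Word) →
               Reduction (A ++ U ++ B) (A ++ V ++ B)

    split : ∀ A U B → ⟦ A ++ U ++ B ⟧ ≡ ⟦ A ⟧ ⊙ (⟦ U ⟧ ⊙ ⟦ B ⟧)
    split A U B = trans (⟦++⟧ A (U ++ B)) (cong (⟦ A ⟧ ⊙_) (⟦++⟧ U B))

    reduction₂ : ∀ {X Y} → Reduction X Y → ⟦ X ⟧ ⇒₂ ⟦ Y ⟧
    reduction₂ (reduce A {U} {V} r B) =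
      coe (sym (split A V B)) ∘ᵥ (⟦ A ⟧ ▷ (rule₂ r ◁ ⟦ B ⟧)) ∘ᵥ coe (split A U B)

    Derivation : Word → Word → Set
    Derivation = Star Reduction

    value : ∀ {X Y} → Derivation X Y → ⟦ X ⟧ ⇒₂ ⟦ Y ⟧
    value ε        = id₂
    value (r ◅ d)  = value d ∘ᵥ reduction₂ r

    PT : Word
    PT = 𝐏 ∷ 𝐓 ∷ []

    PT-Terminal : Set e
    PT-Terminal = ∀ (X : Word) →
      Derivation X PT × (∀ (d d' : Derivation X PT) → value d ≈ value d')

module Submission where

-- We compute in the "word category": morphisms X → Y are 2-cells
-- ⟦X⟧ ⇒ ⟦Y⟧, with tensor ⊗ given by horizontal composition.  Since the
-- strict 1-cell equations only hold propositionally, 2-cells with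
-- propositionally equal boundaries are compared by a transported equality
-- ~, which collapses to ≈ because 1-cells form a set.  In this language
-- both the monad laws and the distributive law axioms become equations
-- between composites of ⊗ and ∙.
--
-- (1) ⇒ (2): every word w has a canonical morphism can w : w → PT, built
-- by absorbing letters one at a time into PT.  Each rule is compatible
-- with absorption (this is where the axioms are used), hence can is
-- natural for reductions, can PT = id, and by induction the value of any
-- derivation w → PT is can w.  Derivations exist by an explicit
-- normalisation strategy.
-- (2) ⇒ (1): each axiom equates the values of two concrete derivations
-- to PT, which agree by terminality.

open import Level using (_⊔_)
open import Defs
open import Function.Bundles using (_⇔_; mk⇔; module Equivalence)
open import Relation.Binary.PropositionalEquality
  using (_≡_; refl; sym; trans; cong₂; subst; subst₂)
open import Relation.Binary.Structures using (IsEquivalence)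
open import Relation.Binary.Bundles using (Setoid)
import Relation.Binary.Reasoning.Setoid as SetoidReasoning
open import Data.List using ([]; _∷_; _++_)
open import Data.Product using (Σ; _,_; proj₂)
open import Relation.Binary.Construct.Closure.ReflexiveTransitive
  using (ε; _◅_; _◅◅_; gmap)

module Coherence {o ℓ₁ ℓ₂ e} (K : TwoCategory o ℓ₁ ℓ₂ e) (𝒞 : TwoCategory.Obj K)
             (P T : TwoCategory._⇒₁_ K 𝒞 𝒞)
             (μP : TwoCategory._⇒₂_ K (TwoCategory._⊙_ K P P) P)
             (ηP : TwoCategory._⇒₂_ K (TwoCategory.id₁ K) P)
             (μT : TwoCategory._⇒₂_ K (TwoCategory._⊙_ K T T) T)
             (ηT : TwoCategory._⇒₂_ K (TwoCategory.id₁ K) T)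
             (θ : TwoCategory._⇒₂_ K (TwoCategory._⊙_ K T P) (TwoCategory._⊙_ K P T)) where
  open TwoCategory K
  open Setup K 𝒞
  open Setup.Data K 𝒞 P T μP ηP μT ηT θ

  Endo : Set ℓ₁
  Endo = 𝒞 ⇒₁ 𝒞

  module ≈ {f g : Endo} = IsEquivalence (≈-isEquivalence {𝒞} {𝒞} {f} {g})

  -- Since
  -- 1-cells form a set, ~ collapses to ≈ on equal boundaries (~⇒≈); it
  -- lets the strict 1-cell equations (associativity, units, ⟦++⟧) be
  -- ignored while computing with 2-cells.
  infix 4 _~_
  _~_ : ∀ {f g f' g' : Endo} → f ⇒₂ g → f' ⇒₂ g' → Set (ℓ₁ ⊔ e)
  _~_ {f} {g} {f'} {g'} α β =
    Σ (f ≡ f') λ p → Σ (g ≡ g') λ q → subst₂ (_⇒₂_ {𝒞} {𝒞}) p q α ≈ β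

  ≈⇒~ : ∀ {f g : Endo} {α β : f ⇒₂ g} → α ≈ β → α ~ β
  ≈⇒~ α≈β = refl , refl , α≈β

  ~⇒≈ : ∀ {f g : Endo} {α β : f ⇒₂ g} → α ~ β → α ≈ β
  ~⇒≈ {α = α} {β} (p , q , α≈β) =
    subst (_≈ β)
      (cong₂ (λ p' q' → subst₂ (_⇒₂_ {𝒞} {𝒞}) p' q' α)
             (⇒₁-isSet p refl) (⇒₁-isSet q refl))
      α≈β

  ~-refl : ∀ {f g : Endo} {α : f ⇒₂ g} → α ~ α
  ~-refl = ≈⇒~ ≈.refl

  ~-sym : ∀ {f g f' g' : Endo} {α : f ⇒₂ g} {β : f' ⇒₂ g'} → α ~ β → β ~ α
  ~-sym (refl , refl , α≈β) = refl , refl , ≈.sym α≈β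

  ~-trans : ∀ {f g f' g' f'' g'' : Endo}
              {α : f ⇒₂ g} {β : f' ⇒₂ g'} {γ : f'' ⇒₂ g''} →
            α ~ β → β ~ γ → α ~ γ
  ~-trans (refl , refl , α≈β) (refl , refl , β≈γ) = refl , refl , ≈.trans α≈β β≈γ

  infixr 2 _~⟨_⟩_
  infix 3 _~∎
  _~⟨_⟩_ : ∀ {f g f' g' f'' g'' : Endo} (α : f ⇒₂ g) {β : f' ⇒₂ g'} {γ : f'' ⇒₂ g''} →
           α ~ β → β ~ γ → α ~ γ
  α ~⟨ α~β ⟩ β~γ = ~-trans α~β β~γ

  _~∎ : ∀ {f g : Endo} (α : f ⇒₂ g) → α ~ α
  α ~∎ = ~-refl

  ~-∘ᵥ : ∀ {f g h f' g' h' : Endo} {α : f ⇒₂ g} {β : g ⇒₂ h}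
           {α' : f' ⇒₂ g'} {β' : g' ⇒₂ h'} →
         β ~ β' → α ~ α' → β ∘ᵥ α ~ β' ∘ᵥ α'
  ~-∘ᵥ (refl , refl , β≈β') (refl , q , α~α') =
    refl , refl , ∘ᵥ-resp-≈ β≈β' (~⇒≈ (refl , q , α~α'))

  ~-∘ₕ : ∀ {f f' g g' f₁ f₁' g₁ g₁' : Endo} {α : f ⇒₂ f'} {β : g ⇒₂ g'}
           {α₁ : f₁ ⇒₂ f₁'} {β₁ : g₁ ⇒₂ g₁'} →
         α ~ α₁ → β ~ β₁ → α ∘ₕ β ~ α₁ ∘ₕ β₁
  ~-∘ₕ (refl , refl , α≈α₁) (refl , refl , β≈β₁) = refl , refl , ∘ₕ-resp-≈ α≈α₁ β≈β₁

  coe~id : ∀ {f g : Endo} {p : f ≡ g} → coe p ~ id₂ {f = f}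
  coe~id {p = refl} = ~-refl

  id~id : ∀ {f g : Endo} → f ≡ g → id₂ {f = f} ~ id₂ {f = g}
  id~id refl = ~-refl

  coe-∘ᵥ : ∀ {f g h f' g' : Endo} {p : g ≡ h} {α : f ⇒₂ g} {α' : f' ⇒₂ g'} →
           α ~ α' → coe p ∘ᵥ α ~ α'
  coe-∘ᵥ {p = refl} α~α' = ~-trans (≈⇒~ ∘ᵥ-identityˡ) α~α'

  ∘ᵥ-coe : ∀ {f g h f' g' : Endo} {p : f ≡ g} {α : g ⇒₂ h} {α' : f' ⇒₂ g'} →
           α ~ α' → α ∘ᵥ coe p ~ α'
  ∘ᵥ-coe {p = refl} α~α' = ~-trans (≈⇒~ ∘ᵥ-identityʳ) α~α'

  coe-square⇒~ : ∀ {f g f' g' : Endo} {α : f ⇒₂ g} {β : f' ⇒₂ g'}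
                   (p : f ≡ f') (q : g ≡ g') →
                 coe q ∘ᵥ α ≈ β ∘ᵥ coe p → α ~ β
  coe-square⇒~ refl refl sq =
    refl , refl , ≈.trans (≈.sym ∘ᵥ-identityˡ) (≈.trans sq ∘ᵥ-identityʳ)

  ∘ₕ-assoc~ : ∀ {f f' g g' h h' : Endo} {α : f ⇒₂ f'} {β : g ⇒₂ g'} {γ : h ⇒₂ h'} →
              (α ∘ₕ β) ∘ₕ γ ~ α ∘ₕ (β ∘ₕ γ)
  ∘ₕ-assoc~ = coe-square⇒~ ⊙-assoc ⊙-assoc ∘ₕ-assoc

  ∘ₕ-identityˡ~ : ∀ {f f' : Endo} {α : f ⇒₂ f'} → id₂ {f = id₁} ∘ₕ α ~ α
  ∘ₕ-identityˡ~ = coe-square⇒~ ⊙-identityˡ ⊙-identityˡ ∘ₕ-identityˡ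

  ∘ₕ-identityʳ~ : ∀ {f f' : Endo} {α : f ⇒₂ f'} → α ∘ₕ id₂ {f = id₁} ~ α
  ∘ₕ-identityʳ~ = coe-square⇒~ ⊙-identityʳ ⊙-identityʳ ∘ₕ-identityʳ

  -- The record wrapper keeps the (non-injective) indices X, Y inferable.
  record Hom (X Y : Word) : Set ℓ₂ where
    constructor ⌜_⌝
    field ap : ⟦ X ⟧ ⇒₂ ⟦ Y ⟧
  open Hom public

  record _≋_ {X Y} (a b : Hom X Y) : Set e where
    constructor ≋i
    field un : ap a ≈ ap b
  open _≋_ public

  infix 4 _≋_
  infixr 9 _∙_
  infixr 10 _⊗_

  HomSetoid : Word → Word → Setoid ℓ₂ e
  HomSetoid X Y = record
    { Carrier       = Hom X Y
    ; _≈_           = _≋_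
    ; isEquivalence = record
      { refl  = ≋i ≈.refl
      ; sym   = λ a≋b → ≋i (≈.sym (un a≋b))
      ; trans = λ a≋b b≋c → ≋i (≈.trans (un a≋b) (un b≋c))
      }
    }

  module ≋ {X Y} = Setoid (HomSetoid X Y)
  module ≋-Reasoning {X Y} = SetoidReasoning (HomSetoid X Y)

  ~⇒≋ : ∀ {X Y} {a b : Hom X Y} → ap a ~ ap b → a ≋ b
  ~⇒≋ a~b = ≋i (~⇒≈ a~b)

  ≋⇒~ : ∀ {X Y} {a b : Hom X Y} → a ≋ b → ap a ~ ap b
  ≋⇒~ a≋b = ≈⇒~ (un a≋b)

  _∙_ : ∀ {X Y Z} → Hom Y Z → Hom X Y → Hom X Z
  b ∙ a = ⌜ ap b ∘ᵥ ap a ⌝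

  ι : ∀ X → Hom X X
  ι X = ⌜ id₂ ⌝

  _⊗_ : ∀ {X Y X' Y'} → Hom X Y → Hom X' Y' → Hom (X ++ X') (Y ++ Y')
  _⊗_ {X} {Y} {X'} {Y'} a b =
    ⌜ coe (sym (⟦++⟧ Y Y')) ∘ᵥ (ap a ∘ₕ ap b) ∘ᵥ coe (⟦++⟧ X X') ⌝

  ⊗~∘ₕ : ∀ {X Y X' Y'} (a : Hom X Y) (b : Hom X' Y') → ap (a ⊗ b) ~ ap a ∘ₕ ap b
  ⊗~∘ₕ a b = coe-∘ᵥ (∘ᵥ-coe ~-refl)

  ∙-assoc : ∀ {W X Y Z} (c : Hom Y Z) (b : Hom X Y) (a : Hom W X) →
            (c ∙ b) ∙ a ≋ c ∙ (b ∙ a)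
  ∙-assoc c b a = ≋i ∘ᵥ-assoc

  ι-∙ : ∀ {X Y} (a : Hom X Y) → ι Y ∙ a ≋ a
  ι-∙ a = ≋i ∘ᵥ-identityˡ

  ∙-ι : ∀ {X Y} (a : Hom X Y) → a ∙ ι X ≋ a
  ∙-ι a = ≋i ∘ᵥ-identityʳ

  ∙-resp : ∀ {X Y Z} {a a' : Hom X Y} {b b' : Hom Y Z} → b ≋ b' → a ≋ a' → b ∙ a ≋ b' ∙ a'
  ∙-resp b≋b' a≋a' = ≋i (∘ᵥ-resp-≈ (un b≋b') (un a≋a'))

  ∙-respˡ : ∀ {X Y Z} (a : Hom X Y) {b b' : Hom Y Z} → b ≋ b' → b ∙ a ≋ b' ∙ a
  ∙-respˡ a b≋b' = ∙-resp b≋b' ≋.refl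

  ∙-respʳ : ∀ {X Y Z} (b : Hom Y Z) {a a' : Hom X Y} → a ≋ a' → b ∙ a ≋ b ∙ a'
  ∙-respʳ b a≋a' = ∙-resp ≋.refl a≋a'

  ⊗-resp : ∀ {X Y X' Y'} {a a' : Hom X Y} {b b' : Hom X' Y'} →
           a ≋ a' → b ≋ b' → a ⊗ b ≋ a' ⊗ b'
  ⊗-resp {a = a} {a'} {b} {b'} a≋a' b≋b' = ~⇒≋
    (ap (a ⊗ b)         ~⟨ ⊗~∘ₕ a b ⟩
     ap a ∘ₕ ap b       ~⟨ ~-∘ₕ (≋⇒~ a≋a') (≋⇒~ b≋b') ⟩
     ap a' ∘ₕ ap b'     ~⟨ ~-sym (⊗~∘ₕ a' b') ⟩
     ap (a' ⊗ b')       ~∎)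

  ⊗-respˡ : ∀ {X Y X' Y'} {a a' : Hom X Y} (b : Hom X' Y') → a ≋ a' → a ⊗ b ≋ a' ⊗ b
  ⊗-respˡ b a≋a' = ⊗-resp a≋a' ≋.refl

  ⊗-respʳ : ∀ {X Y X' Y'} (a : Hom X Y) {b b' : Hom X' Y'} → b ≋ b' → a ⊗ b ≋ a ⊗ b'
  ⊗-respʳ a b≋b' = ⊗-resp ≋.refl b≋b'

  -- associativity holds only up to ~, as (X ++ X') ++ X'' is not
  -- definitionally X ++ (X' ++ X''); on concrete words ~⇒≋ applies
  ⊗-assoc~ : ∀ {X Y X' Y' X'' Y''} (a : Hom X Y) (b : Hom X' Y') (c : Hom X'' Y'') →
             ap ((a ⊗ b) ⊗ c) ~ ap (a ⊗ (b ⊗ c))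
  ⊗-assoc~ a b c =
    ap ((a ⊗ b) ⊗ c)          ~⟨ ⊗~∘ₕ (a ⊗ b) c ⟩
    ap (a ⊗ b) ∘ₕ ap c        ~⟨ ~-∘ₕ (⊗~∘ₕ a b) ~-refl ⟩
    (ap a ∘ₕ ap b) ∘ₕ ap c    ~⟨ ∘ₕ-assoc~ ⟩
    ap a ∘ₕ (ap b ∘ₕ ap c)    ~⟨ ~-∘ₕ ~-refl (~-sym (⊗~∘ₕ b c)) ⟩
    ap a ∘ₕ ap (b ⊗ c)        ~⟨ ~-sym (⊗~∘ₕ a (b ⊗ c)) ⟩
    ap (a ⊗ (b ⊗ c))          ~∎

  ι⊗ι~ : ∀ X Y → ap (ι X ⊗ ι Y) ~ ap (ι (X ++ Y))
  ι⊗ι~ X Y = ~-trans (⊗~∘ₕ (ι X) (ι Y)) (~-trans (≈⇒~ ∘ₕ-id) (id~id (sym (⟦++⟧ X Y))))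

  ι⊗ι : ∀ X Y → ι X ⊗ ι Y ≋ ι (X ++ Y)
  ι⊗ι X Y = ~⇒≋ (ι⊗ι~ X Y)

  ι[]-⊗ : ∀ {X Y} (a : Hom X Y) → ι [] ⊗ a ≋ a
  ι[]-⊗ a = ~⇒≋ (~-trans (⊗~∘ₕ (ι []) a) ∘ₕ-identityˡ~)

  ⊗-interchange : ∀ {X Y Z X' Y' Z'} (a : Hom X Y) (a' : Hom Y Z)
                    (b : Hom X' Y') (b' : Hom Y' Z') →
                  (a' ∙ a) ⊗ (b' ∙ b) ≋ (a' ⊗ b') ∙ (a ⊗ b)
  ⊗-interchange a a' b b' = ~⇒≋
    (ap ((a' ∙ a) ⊗ (b' ∙ b))                  ~⟨ ⊗~∘ₕ (a' ∙ a) (b' ∙ b) ⟩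
     (ap a' ∘ᵥ ap a) ∘ₕ (ap b' ∘ᵥ ap b)        ~⟨ ≈⇒~ interchange ⟩
     (ap a' ∘ₕ ap b') ∘ᵥ (ap a ∘ₕ ap b)        ~⟨ ~-∘ᵥ (~-sym (⊗~∘ₕ a' b')) (~-sym (⊗~∘ₕ a b)) ⟩
     ap ((a' ⊗ b') ∙ (a ⊗ b))                  ~∎)

  ι-⊗-∙ : ∀ X {A B C} (b : Hom A B) (b' : Hom B C) →
          ι X ⊗ (b' ∙ b) ≋ (ι X ⊗ b') ∙ (ι X ⊗ b)
  ι-⊗-∙ X b b' = ≋.trans (⊗-respˡ (b' ∙ b) (≋.sym (ι-∙ (ι X)))) (⊗-interchange (ι X) (ι X) b b')

  ∙-⊗-ι : ∀ X {A B C} (b : Hom A B) (b' : Hom B C) →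
          (b' ∙ b) ⊗ ι X ≋ (b' ⊗ ι X) ∙ (b ⊗ ι X)
  ∙-⊗-ι X b b' = ≋.trans (⊗-respʳ (b' ∙ b) (≋.sym (ι-∙ (ι X)))) (⊗-interchange b b' (ι X) (ι X))

  ⊗-slide : ∀ {X Y X' Y'} (a : Hom X Y) (b : Hom X' Y') →
            (a ⊗ ι Y') ∙ (ι X ⊗ b) ≋ (ι Y ⊗ b) ∙ (a ⊗ ι X')
  ⊗-slide {X} {Y} {X'} {Y'} a b = begin
    (a ⊗ ι Y') ∙ (ι X ⊗ b)   ≈⟨ ⊗-interchange (ι X) a b (ι Y') ⟨
    (a ∙ ι X) ⊗ (ι Y' ∙ b)   ≈⟨ ⊗-resp (≋.trans (∙-ι a) (≋.sym (ι-∙ a)))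
                                       (≋.trans (ι-∙ b) (≋.sym (∙-ι b))) ⟩
    (ι Y ∙ a) ⊗ (b ∙ ι X')   ≈⟨ ⊗-interchange a (ι Y) (ι X') b ⟩
    (ι Y ⊗ b) ∙ (a ⊗ ι X')   ∎
    where open ≋-Reasoning

  ≈⇔≋ : ∀ {X Y} {f g : Endo} {α β : f ⇒₂ g} {a b : Hom X Y} →
        α ~ ap a → β ~ ap b → (α ≈ β) ⇔ (a ≋ b)
  ≈⇔≋ α~a β~b = mk⇔
    (λ α≈β → ~⇒≋ (~-trans (~-sym α~a) (~-trans (≈⇒~ α≈β) β~b)))
    (λ a≋b → ~⇒≈ (~-trans α~a (~-trans (≋⇒~ a≋b) (~-sym β~b))))

  [_] : Letter → Word
  [ x ] = x ∷ []

  mP : Hom (𝐏 ∷ 𝐏 ∷ []) [ 𝐏 ]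
  mP = ⌜ μP ⌝
  eP : Hom [] [ 𝐏 ]
  eP = ⌜ ηP ⌝
  mT : Hom (𝐓 ∷ 𝐓 ∷ []) [ 𝐓 ]
  mT = ⌜ μT ⌝
  eT : Hom [] [ 𝐓 ]
  eT = ⌜ ηT ⌝
  th : Hom (𝐓 ∷ 𝐏 ∷ []) (𝐏 ∷ 𝐓 ∷ [])
  th = ⌜ θ ⌝
  iP : Hom [ 𝐏 ] [ 𝐏 ]
  iP = ι [ 𝐏 ]
  iT : Hom [ 𝐓 ] [ 𝐓 ]
  iT = ι [ 𝐓 ]

  ▷~ι⊗ : ∀ x {U V} (a : Hom U V) → letter x ▷ ap a ~ ap (ι [ x ] ⊗ a)
  ▷~ι⊗ x a = ~-sym (⊗~∘ₕ (ι [ x ]) a)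

  ◁~⊗ι : ∀ x {U V} (a : Hom U V) → ap a ◁ letter x ~ ap (a ⊗ ι [ x ])
  ◁~⊗ι x a = ~-sym (⊗~∘ₕ a (ι [ x ]))

  module MonadLaws (x : Letter) (μ : Hom (x ∷ x ∷ []) [ x ]) (η : Hom [] [ x ])
                  (monad : IsMonad (letter x) (ap μ) (ap η)) where
    open IsMonad monad

    μ-assoc : μ ∙ (μ ⊗ ι [ x ]) ≋ μ ∙ (ι [ x ] ⊗ μ)
    μ-assoc = Equivalence.to (≈⇔≋ (~-∘ᵥ ~-refl (◁~⊗ι x μ))
                          (∘ᵥ-coe (~-∘ᵥ ~-refl (▷~ι⊗ x μ)))) assoc

    μ-η-left : μ ∙ (η ⊗ ι [ x ]) ≋ ι [ x ]
    μ-η-left = Equivalence.to (≈⇔≋ (~-∘ᵥ ~-refl (◁~⊗ι x η))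
                           (~-trans coe~id (id~id ⊙-identityˡ))) identityˡ

    μ-η-right : μ ∙ (ι [ x ] ⊗ η) ≋ ι [ x ]
    μ-η-right = Equivalence.to (≈⇔≋ (~-∘ᵥ ~-refl (▷~ι⊗ x η))
                            (~-trans coe~id (id~id ⊙-identityʳ))) identityʳ

  record IsDistributiveLawʷ : Set e where
    field
      θ-μP : th ∙ (iT ⊗ mP) ≋ (mP ⊗ iT) ∙ (iP ⊗ th) ∙ (th ⊗ iP)
      θ-μT : th ∙ (mT ⊗ iP) ≋ (iP ⊗ mT) ∙ (th ⊗ iT) ∙ (iT ⊗ th)
      θ-ηP : th ∙ (iT ⊗ eP) ≋ eP ⊗ iT
      θ-ηT : th ∙ (eT ⊗ iP) ≋ iP ⊗ eT

  distributiveLaw⇔ʷ : IsDistributiveLaw ⇔ IsDistributiveLawʷ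
  distributiveLaw⇔ʷ = mk⇔
    (λ d → let open IsDistributiveLaw d in record
      { θ-μP = Equivalence.to θ-μP⇔ dist-μP ; θ-μT = Equivalence.to θ-μT⇔ dist-μT
      ; θ-ηP = Equivalence.to θ-ηP⇔ dist-ηP ; θ-ηT = Equivalence.to θ-ηT⇔ dist-ηT })
    (λ d → let open IsDistributiveLawʷ d in record
      { dist-μP = Equivalence.from θ-μP⇔ θ-μP ; dist-μT = Equivalence.from θ-μT⇔ θ-μT
      ; dist-ηP = Equivalence.from θ-ηP⇔ θ-ηP ; dist-ηT = Equivalence.from θ-ηT⇔ θ-ηT })
    where
    θ-μP⇔ : (θ ∘ᵥ (T ▷ μP)
             ≈ (μP ◁ T) ∘ᵥ coe (sym ⊙-assoc) ∘ᵥ (P ▷ θ) ∘ᵥ coe ⊙-assoc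
                 ∘ᵥ (θ ◁ P) ∘ᵥ coe (sym ⊙-assoc))
            ⇔ (th ∙ (iT ⊗ mP) ≋ (mP ⊗ iT) ∙ (iP ⊗ th) ∙ (th ⊗ iP))
    θ-μP⇔ = ≈⇔≋ (~-∘ᵥ ~-refl (▷~ι⊗ 𝐓 mP))
      (~-∘ᵥ (◁~⊗ι 𝐓 mP) (coe-∘ᵥ (~-∘ᵥ (▷~ι⊗ 𝐏 th) (coe-∘ᵥ (∘ᵥ-coe (◁~⊗ι 𝐏 th))))))

    θ-μT⇔ : (θ ∘ᵥ (μT ◁ P)
             ≈ (P ▷ μT) ∘ᵥ coe ⊙-assoc ∘ᵥ (θ ◁ T) ∘ᵥ coe (sym ⊙-assoc)
                 ∘ᵥ (T ▷ θ) ∘ᵥ coe ⊙-assoc)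
            ⇔ (th ∙ (mT ⊗ iP) ≋ (iP ⊗ mT) ∙ (th ⊗ iT) ∙ (iT ⊗ th))
    θ-μT⇔ = ≈⇔≋ (~-∘ᵥ ~-refl (◁~⊗ι 𝐏 mT))
      (~-∘ᵥ (▷~ι⊗ 𝐏 mT) (coe-∘ᵥ (~-∘ᵥ (◁~⊗ι 𝐓 th) (coe-∘ᵥ (∘ᵥ-coe (▷~ι⊗ 𝐓 th))))))

    θ-ηP⇔ : (θ ∘ᵥ (T ▷ ηP) ≈ (ηP ◁ T) ∘ᵥ coe (trans ⊙-identityʳ (sym ⊙-identityˡ)))
            ⇔ (th ∙ (iT ⊗ eP) ≋ eP ⊗ iT)
    θ-ηP⇔ = ≈⇔≋ (~-∘ᵥ ~-refl (▷~ι⊗ 𝐓 eP)) (∘ᵥ-coe (◁~⊗ι 𝐓 eP))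

    θ-ηT⇔ : (θ ∘ᵥ (ηT ◁ P) ≈ (P ▷ ηT) ∘ᵥ coe (trans ⊙-identityˡ (sym ⊙-identityʳ)))
            ⇔ (th ∙ (eT ⊗ iP) ≋ iP ⊗ eT)
    θ-ηT⇔ = ≈⇔≋ (~-∘ᵥ ~-refl (◁~⊗ι 𝐏 eT)) (∘ᵥ-coe (▷~ι⊗ 𝐏 eT))

  rule : ∀ {U V} → Rule U V → Hom U V
  rule r = ⌜ rule₂ r ⌝

  reduction : ∀ {X Y} → Reduction X Y → Hom X Y
  reduction ρ = ⌜ reduction₂ ρ ⌝

  valueʷ : ∀ {X Y} → Derivation X Y → Hom X Y
  valueʷ δ = ⌜ value δ ⌝

  reduction~ : ∀ A {U V} (r : Rule U V) B →
               ap (reduction (reduce A r B)) ~ id₂ {f = ⟦ A ⟧} ∘ₕ (rule₂ r ∘ₕ id₂ {f = ⟦ B ⟧})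
  reduction~ A r B = coe-∘ᵥ (∘ᵥ-coe ~-refl)

  reduction-whisker : ∀ A {U V} (r : Rule U V) B →
                      reduction (reduce A r B) ≋ ι A ⊗ (rule r ⊗ ι B)
  reduction-whisker A r B = ~⇒≋
    (ap (reduction (reduce A r B))         ~⟨ reduction~ A r B ⟩
     id₂ ∘ₕ (rule₂ r ∘ₕ id₂)              ~⟨ ~-∘ₕ ~-refl (~-sym (⊗~∘ₕ (rule r) (ι B))) ⟩
     id₂ ∘ₕ ap (rule r ⊗ ι B)              ~⟨ ~-sym (⊗~∘ₕ (ι A) (rule r ⊗ ι B)) ⟩
     ap (ι A ⊗ (rule r ⊗ ι B))             ~∎)

  step : ∀ x → Hom (x ∷ PT) PT
  step 𝐏 = mP ⊗ iT
  step 𝐓 = (iP ⊗ mT) ∙ (th ⊗ iT)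

  absorb : ∀ U → Hom (U ++ PT) PT
  absorb []      = ι PT
  absorb (x ∷ U) = step x ∙ (ι [ x ] ⊗ absorb U)

  can : ∀ w → Hom w PT
  can []      = eP ⊗ eT
  can (x ∷ w) = step x ∙ (ι [ x ] ⊗ can w)

  absorb-single : ∀ x → absorb [ x ] ≋ step x
  absorb-single x = ≋.trans (∙-respʳ (step x) (ι⊗ι [ x ] PT)) (∙-ι (step x))

  absorb-pair : ∀ x y → absorb (x ∷ y ∷ []) ≋ step x ∙ (ι [ x ] ⊗ step y)
  absorb-pair x y = ∙-respʳ (step x) (⊗-respʳ (ι [ x ]) (absorb-single y))

  ι-cons-⊗ : ∀ x U {Y Z} (c : Hom Y Z) → ι (x ∷ U) ⊗ c ≋ ι [ x ] ⊗ (ι U ⊗ c)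
  ι-cons-⊗ x U c = ≋.trans (⊗-respˡ c (≋.sym (ι⊗ι [ x ] U))) (~⇒≋ (⊗-assoc~ (ι [ x ]) (ι U) c))

  can-split : ∀ U B → can (U ++ B) ≋ absorb U ∙ (ι U ⊗ can B)
  can-split [] B = begin
    can B                    ≈⟨ ι[]-⊗ (can B) ⟨
    ι [] ⊗ can B             ≈⟨ ι-∙ (ι [] ⊗ can B) ⟨
    ι PT ∙ (ι [] ⊗ can B)    ∎
    where open ≋-Reasoning
  can-split (x ∷ U) B = begin
    step x ∙ (ι [ x ] ⊗ can (U ++ B))
      ≈⟨ ∙-respʳ (step x) (⊗-respʳ (ι [ x ]) (can-split U B)) ⟩
    step x ∙ (ι [ x ] ⊗ (absorb U ∙ (ι U ⊗ can B)))
      ≈⟨ ∙-respʳ (step x) (ι-⊗-∙ [ x ] (ι U ⊗ can B) (absorb U)) ⟩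
    step x ∙ ((ι [ x ] ⊗ absorb U) ∙ (ι [ x ] ⊗ (ι U ⊗ can B)))
      ≈⟨ ∙-assoc (step x) (ι [ x ] ⊗ absorb U) (ι [ x ] ⊗ (ι U ⊗ can B)) ⟨
    absorb (x ∷ U) ∙ (ι [ x ] ⊗ (ι U ⊗ can B))
      ≈⟨ ∙-respʳ (absorb (x ∷ U)) (ι-cons-⊗ x U (can B)) ⟨
    absorb (x ∷ U) ∙ (ι (x ∷ U) ⊗ can B)
      ∎
    where open ≋-Reasoning

  Compatible : ∀ {U V} → Hom U V → Set e
  Compatible {U} {V} φ = absorb V ∙ (φ ⊗ ι PT) ≋ absorb U

  can-natural : ∀ A {U V} (φ : Hom U V) → Compatible φ → ∀ B →
                can (A ++ V ++ B) ∙ (ι A ⊗ (φ ⊗ ι B)) ≋ can (A ++ U ++ B)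
  can-natural [] {U} {V} φ compatible B = begin
    can (V ++ B) ∙ (ι [] ⊗ (φ ⊗ ι B))          ≈⟨ ∙-respʳ (can (V ++ B)) (ι[]-⊗ (φ ⊗ ι B)) ⟩
    can (V ++ B) ∙ (φ ⊗ ι B)                   ≈⟨ ∙-respˡ (φ ⊗ ι B) (can-split V B) ⟩
    (absorb V ∙ (ι V ⊗ can B)) ∙ (φ ⊗ ι B)     ≈⟨ ∙-assoc (absorb V) (ι V ⊗ can B) (φ ⊗ ι B) ⟩
    absorb V ∙ ((ι V ⊗ can B) ∙ (φ ⊗ ι B))     ≈⟨ ∙-respʳ (absorb V) (⊗-slide φ (can B)) ⟨
    absorb V ∙ ((φ ⊗ ι PT) ∙ (ι U ⊗ can B))    ≈⟨ ∙-assoc (absorb V) (φ ⊗ ι PT) (ι U ⊗ can B) ⟨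
    (absorb V ∙ (φ ⊗ ι PT)) ∙ (ι U ⊗ can B)    ≈⟨ ∙-respˡ (ι U ⊗ can B) compatible ⟩
    absorb U ∙ (ι U ⊗ can B)                   ≈⟨ can-split U B ⟨
    can (U ++ B)                               ∎
    where open ≋-Reasoning
  can-natural (x ∷ A) {U} {V} φ compatible B = begin
    (step x ∙ (ι [ x ] ⊗ can (A ++ V ++ B))) ∙ (ι (x ∷ A) ⊗ (φ ⊗ ι B))
      ≈⟨ ∙-respʳ (can (x ∷ A ++ V ++ B)) (ι-cons-⊗ x A (φ ⊗ ι B)) ⟩
    (step x ∙ (ι [ x ] ⊗ can (A ++ V ++ B))) ∙ (ι [ x ] ⊗ (ι A ⊗ (φ ⊗ ι B)))
      ≈⟨ ∙-assoc (step x) (ι [ x ] ⊗ can (A ++ V ++ B)) (ι [ x ] ⊗ (ι A ⊗ (φ ⊗ ι B))) ⟩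
    step x ∙ ((ι [ x ] ⊗ can (A ++ V ++ B)) ∙ (ι [ x ] ⊗ (ι A ⊗ (φ ⊗ ι B))))
      ≈⟨ ∙-respʳ (step x) (ι-⊗-∙ [ x ] (ι A ⊗ (φ ⊗ ι B)) (can (A ++ V ++ B))) ⟨
    step x ∙ (ι [ x ] ⊗ (can (A ++ V ++ B) ∙ (ι A ⊗ (φ ⊗ ι B))))
      ≈⟨ ∙-respʳ (step x) (⊗-respʳ (ι [ x ]) (can-natural A φ compatible B)) ⟩
    step x ∙ (ι [ x ] ⊗ can (A ++ U ++ B))
      ∎
    where open ≋-Reasoning

  value-canonical : (∀ {U V} (r : Rule U V) → Compatible (rule r)) → can PT ≋ ι PT →
                    ∀ {X} (δ : Derivation X PT) → valueʷ δ ≋ can X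
  value-canonical compatible can-PT ε = ≋.sym can-PT
  value-canonical compatible can-PT (reduce A {U} {V} r B ◅ δ) = begin
    valueʷ δ ∙ reduction (reduce A r B)             ≈⟨ ∙-resp (value-canonical compatible can-PT δ)
                                                             (reduction-whisker A r B) ⟩
    can (A ++ V ++ B) ∙ (ι A ⊗ (rule r ⊗ ι B))      ≈⟨ can-natural A (rule r) (compatible r) B ⟩
    can (A ++ U ++ B)                               ∎
    where open ≋-Reasoning

  ⊗-ιPT~ : ∀ {X Y} (a : Hom X Y) → ap (a ⊗ ι PT) ~ ap ((a ⊗ iP) ⊗ iT)
  ⊗-ιPT~ a =
    ap (a ⊗ ι PT)            ~⟨ ⊗~∘ₕ a (ι PT) ⟩
    ap a ∘ₕ id₂              ~⟨ ~-∘ₕ ~-refl (~-sym (ι⊗ι~ [ 𝐏 ] [ 𝐓 ])) ⟩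
    ap a ∘ₕ ap (iP ⊗ iT)     ~⟨ ~-sym (⊗~∘ₕ a (iP ⊗ iT)) ⟩
    ap (a ⊗ (iP ⊗ iT))       ~⟨ ~-sym (⊗-assoc~ a iP iT) ⟩
    ap ((a ⊗ iP) ⊗ iT)       ~∎

  module Compatibility (monadP : IsMonad P μP ηP) (monadT : IsMonad T μT ηT)
                       (dist : IsDistributiveLawʷ) where
    open MonadLaws 𝐏 mP eP monadP
      renaming (μ-assoc to μP-assoc; μ-η-left to μP-ηP-left; μ-η-right to μP-ηP-right)
    open MonadLaws 𝐓 mT eT monadT
      renaming (μ-assoc to μT-assoc; μ-η-left to μT-ηT-left; μ-η-right to μT-ηT-right)
    open IsDistributiveLawʷ dist
    open ≋-Reasoning

    compatible-μP : Compatible mP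
    compatible-μP = begin
      absorb [ 𝐏 ] ∙ (mP ⊗ ι PT)          ≈⟨ ∙-resp (absorb-single 𝐏) (~⇒≋ (⊗-ιPT~ mP)) ⟩
      (mP ⊗ iT) ∙ ((mP ⊗ iP) ⊗ iT)        ≈⟨ ∙-⊗-ι [ 𝐓 ] (mP ⊗ iP) mP ⟨
      (mP ∙ (mP ⊗ iP)) ⊗ iT               ≈⟨ ⊗-respˡ iT μP-assoc ⟩
      (mP ∙ (iP ⊗ mP)) ⊗ iT               ≈⟨ ∙-⊗-ι [ 𝐓 ] (iP ⊗ mP) mP ⟩
      (mP ⊗ iT) ∙ ((iP ⊗ mP) ⊗ iT)        ≈⟨ ∙-respʳ (mP ⊗ iT) (~⇒≋ (⊗-assoc~ iP mP iT)) ⟩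
      step 𝐏 ∙ (iP ⊗ step 𝐏)              ≈⟨ absorb-pair 𝐏 𝐏 ⟨
      absorb (𝐏 ∷ 𝐏 ∷ [])                 ∎

    compatible-ηP : Compatible eP
    compatible-ηP = begin
      absorb [ 𝐏 ] ∙ (eP ⊗ ι PT)          ≈⟨ ∙-resp (absorb-single 𝐏) (~⇒≋ (⊗-ιPT~ eP)) ⟩
      (mP ⊗ iT) ∙ ((eP ⊗ iP) ⊗ iT)        ≈⟨ ∙-⊗-ι [ 𝐓 ] (eP ⊗ iP) mP ⟨
      (mP ∙ (eP ⊗ iP)) ⊗ iT               ≈⟨ ⊗-respˡ iT μP-ηP-left ⟩
      iP ⊗ iT                             ≈⟨ ι⊗ι [ 𝐏 ] [ 𝐓 ] ⟩
      ι PT                                ∎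

    compatible-ηT : Compatible eT
    compatible-ηT = begin
      absorb [ 𝐓 ] ∙ (eT ⊗ ι PT)
        ≈⟨ ∙-resp (absorb-single 𝐓) (~⇒≋ (⊗-ιPT~ eT)) ⟩
      ((iP ⊗ mT) ∙ (th ⊗ iT)) ∙ ((eT ⊗ iP) ⊗ iT)
        ≈⟨ ∙-assoc (iP ⊗ mT) (th ⊗ iT) ((eT ⊗ iP) ⊗ iT) ⟩
      (iP ⊗ mT) ∙ ((th ⊗ iT) ∙ ((eT ⊗ iP) ⊗ iT))
        ≈⟨ ∙-respʳ (iP ⊗ mT) (∙-⊗-ι [ 𝐓 ] (eT ⊗ iP) th) ⟨
      (iP ⊗ mT) ∙ ((th ∙ (eT ⊗ iP)) ⊗ iT)
        ≈⟨ ∙-respʳ (iP ⊗ mT) (⊗-respˡ iT θ-ηT) ⟩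
      (iP ⊗ mT) ∙ ((iP ⊗ eT) ⊗ iT)
        ≈⟨ ∙-respʳ (iP ⊗ mT) (~⇒≋ (⊗-assoc~ iP eT iT)) ⟩
      (iP ⊗ mT) ∙ (iP ⊗ (eT ⊗ iT))
        ≈⟨ ι-⊗-∙ [ 𝐏 ] (eT ⊗ iT) mT ⟨
      iP ⊗ (mT ∙ (eT ⊗ iT))
        ≈⟨ ⊗-respʳ iP μT-ηT-left ⟩
      iP ⊗ iT
        ≈⟨ ι⊗ι [ 𝐏 ] [ 𝐓 ] ⟩
      ι PT
        ∎

    -- θ ∘ μᵀP = Pμᵀ ∘ θT ∘ Tθ, together with associativity of μᵀ;
    -- both sides are brought to the form  Pμᵀ ∘ (Pμᵀ ∘ θT ∘ Tθ)T
    compatible-μT : Compatible mT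
    compatible-μT = ≋.trans via-θ-μT (≋.sym via-μT-assoc)
      where
      normal : Hom (𝐓 ∷ 𝐓 ∷ 𝐏 ∷ 𝐓 ∷ []) PT
      normal = (iP ⊗ mT) ∙ ((iP ⊗ mT) ⊗ iT) ∙ ((th ⊗ iT) ⊗ iT) ∙ ((iT ⊗ th) ⊗ iT)

      via-θ-μT : absorb [ 𝐓 ] ∙ (mT ⊗ ι PT) ≋ normal
      via-θ-μT = begin
        absorb [ 𝐓 ] ∙ (mT ⊗ ι PT)
          ≈⟨ ∙-resp (absorb-single 𝐓) (~⇒≋ (⊗-ιPT~ mT)) ⟩
        ((iP ⊗ mT) ∙ (th ⊗ iT)) ∙ ((mT ⊗ iP) ⊗ iT)
          ≈⟨ ∙-assoc (iP ⊗ mT) (th ⊗ iT) ((mT ⊗ iP) ⊗ iT) ⟩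
        (iP ⊗ mT) ∙ ((th ⊗ iT) ∙ ((mT ⊗ iP) ⊗ iT))
          ≈⟨ ∙-respʳ (iP ⊗ mT) (∙-⊗-ι [ 𝐓 ] (mT ⊗ iP) th) ⟨
        (iP ⊗ mT) ∙ ((th ∙ (mT ⊗ iP)) ⊗ iT)
          ≈⟨ ∙-respʳ (iP ⊗ mT) (⊗-respˡ iT θ-μT) ⟩
        (iP ⊗ mT) ∙ (((iP ⊗ mT) ∙ (th ⊗ iT) ∙ (iT ⊗ th)) ⊗ iT)
          ≈⟨ ∙-respʳ (iP ⊗ mT) (≋.trans (∙-⊗-ι [ 𝐓 ] ((th ⊗ iT) ∙ (iT ⊗ th)) (iP ⊗ mT))
               (∙-respʳ ((iP ⊗ mT) ⊗ iT) (∙-⊗-ι [ 𝐓 ] (iT ⊗ th) (th ⊗ iT)))) ⟩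
        normal
          ∎

      -- θT and TPμᵀ act on disjoint parts of TPTT
      θ-slides-past-μT : (th ⊗ iT) ∙ (iT ⊗ (iP ⊗ mT)) ≋ (iP ⊗ (iT ⊗ mT)) ∙ ((th ⊗ iT) ⊗ iT)
      θ-slides-past-μT = begin
        (th ⊗ iT) ∙ (iT ⊗ (iP ⊗ mT))
          ≈⟨ ∙-respʳ (th ⊗ iT) (≋.trans (~⇒≋ (~-sym (⊗-assoc~ iT iP mT)))
                                        (⊗-respˡ mT (ι⊗ι [ 𝐓 ] [ 𝐏 ]))) ⟩
        (th ⊗ iT) ∙ (ι (𝐓 ∷ 𝐏 ∷ []) ⊗ mT)
          ≈⟨ ⊗-slide th mT ⟩
        (ι PT ⊗ mT) ∙ (th ⊗ ι (𝐓 ∷ 𝐓 ∷ []))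
          ≈⟨ ∙-resp (≋.trans (⊗-respˡ mT (≋.sym (ι⊗ι [ 𝐏 ] [ 𝐓 ]))) (~⇒≋ (⊗-assoc~ iP iT mT)))
                    (≋.trans (⊗-respʳ th (≋.sym (ι⊗ι [ 𝐓 ] [ 𝐓 ]))) (~⇒≋ (~-sym (⊗-assoc~ th iT iT)))) ⟩
        (iP ⊗ (iT ⊗ mT)) ∙ ((th ⊗ iT) ⊗ iT)
          ∎

      μT-assoc-under-P : (iP ⊗ mT) ∙ (iP ⊗ (iT ⊗ mT)) ≋ (iP ⊗ mT) ∙ ((iP ⊗ mT) ⊗ iT)
      μT-assoc-under-P = begin
        (iP ⊗ mT) ∙ (iP ⊗ (iT ⊗ mT))    ≈⟨ ι-⊗-∙ [ 𝐏 ] (iT ⊗ mT) mT ⟨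
        iP ⊗ (mT ∙ (iT ⊗ mT))           ≈⟨ ⊗-respʳ iP μT-assoc ⟨
        iP ⊗ (mT ∙ (mT ⊗ iT))           ≈⟨ ι-⊗-∙ [ 𝐏 ] (mT ⊗ iT) mT ⟩
        (iP ⊗ mT) ∙ (iP ⊗ (mT ⊗ iT))    ≈⟨ ∙-respʳ (iP ⊗ mT) (~⇒≋ (~-sym (⊗-assoc~ iP mT iT))) ⟩
        (iP ⊗ mT) ∙ ((iP ⊗ mT) ⊗ iT)    ∎

      via-μT-assoc : absorb (𝐓 ∷ 𝐓 ∷ []) ≋ normal
      via-μT-assoc = begin
        absorb (𝐓 ∷ 𝐓 ∷ [])
          ≈⟨ absorb-pair 𝐓 𝐓 ⟩
        step 𝐓 ∙ (iT ⊗ ((iP ⊗ mT) ∙ (th ⊗ iT)))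
          ≈⟨ ∙-respʳ (step 𝐓) (ι-⊗-∙ [ 𝐓 ] (th ⊗ iT) (iP ⊗ mT)) ⟩
        ((iP ⊗ mT) ∙ (th ⊗ iT)) ∙ (iT ⊗ (iP ⊗ mT)) ∙ (iT ⊗ (th ⊗ iT))
          ≈⟨ ∙-assoc (iP ⊗ mT) (th ⊗ iT) _ ⟩
        (iP ⊗ mT) ∙ (th ⊗ iT) ∙ (iT ⊗ (iP ⊗ mT)) ∙ (iT ⊗ (th ⊗ iT))
          ≈⟨ ∙-respʳ (iP ⊗ mT) (∙-assoc (th ⊗ iT) (iT ⊗ (iP ⊗ mT)) (iT ⊗ (th ⊗ iT))) ⟨
        (iP ⊗ mT) ∙ ((th ⊗ iT) ∙ (iT ⊗ (iP ⊗ mT))) ∙ (iT ⊗ (th ⊗ iT))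
          ≈⟨ ∙-respʳ (iP ⊗ mT) (∙-respˡ (iT ⊗ (th ⊗ iT)) θ-slides-past-μT) ⟩
        (iP ⊗ mT) ∙ ((iP ⊗ (iT ⊗ mT)) ∙ ((th ⊗ iT) ⊗ iT)) ∙ (iT ⊗ (th ⊗ iT))
          ≈⟨ ∙-respʳ (iP ⊗ mT) (∙-assoc (iP ⊗ (iT ⊗ mT)) ((th ⊗ iT) ⊗ iT) (iT ⊗ (th ⊗ iT))) ⟩
        (iP ⊗ mT) ∙ (iP ⊗ (iT ⊗ mT)) ∙ ((th ⊗ iT) ⊗ iT) ∙ (iT ⊗ (th ⊗ iT))
          ≈⟨ ∙-assoc (iP ⊗ mT) (iP ⊗ (iT ⊗ mT)) _ ⟨
        ((iP ⊗ mT) ∙ (iP ⊗ (iT ⊗ mT))) ∙ ((th ⊗ iT) ⊗ iT) ∙ (iT ⊗ (th ⊗ iT))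
          ≈⟨ ∙-resp μT-assoc-under-P (∙-respʳ ((th ⊗ iT) ⊗ iT) (~⇒≋ (~-sym (⊗-assoc~ iT th iT)))) ⟩
        ((iP ⊗ mT) ∙ ((iP ⊗ mT) ⊗ iT)) ∙ ((th ⊗ iT) ⊗ iT) ∙ ((iT ⊗ th) ⊗ iT)
          ≈⟨ ∙-assoc (iP ⊗ mT) ((iP ⊗ mT) ⊗ iT) _ ⟩
        normal
          ∎

    -- θ ∘ Tμᴾ = μᴾT ∘ Pθ ∘ θP; both sides are brought to the form
    -- Pμᵀ ∘ (μᴾT ∘ Pθ ∘ θP)T
    compatible-θ : Compatible th
    compatible-θ = ≋.trans via-naturality (≋.sym via-θ-μP)
      where
      normal : Hom (𝐓 ∷ 𝐏 ∷ 𝐏 ∷ 𝐓 ∷ []) PT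
      normal = (iP ⊗ mT) ∙ ((mP ⊗ iT) ⊗ iT) ∙ ((iP ⊗ th) ⊗ iT) ∙ ((th ⊗ iP) ⊗ iT)

      -- μᴾTT and PPμᵀ act on disjoint parts of PPTT
      μP-slides-past-μT : (mP ⊗ iT) ∙ (iP ⊗ (iP ⊗ mT)) ≋ (iP ⊗ mT) ∙ ((mP ⊗ iT) ⊗ iT)
      μP-slides-past-μT = begin
        (mP ⊗ iT) ∙ (iP ⊗ (iP ⊗ mT))
          ≈⟨ ∙-respʳ (mP ⊗ iT) (≋.trans (~⇒≋ (~-sym (⊗-assoc~ iP iP mT)))
                                        (⊗-respˡ mT (ι⊗ι [ 𝐏 ] [ 𝐏 ]))) ⟩
        (mP ⊗ iT) ∙ (ι (𝐏 ∷ 𝐏 ∷ []) ⊗ mT)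
          ≈⟨ ⊗-slide mP mT ⟩
        (iP ⊗ mT) ∙ (mP ⊗ ι (𝐓 ∷ 𝐓 ∷ []))
          ≈⟨ ∙-respʳ (iP ⊗ mT) (≋.trans (⊗-respʳ mP (≋.sym (ι⊗ι [ 𝐓 ] [ 𝐓 ])))
                                        (~⇒≋ (~-sym (⊗-assoc~ mP iT iT)))) ⟩
        (iP ⊗ mT) ∙ ((mP ⊗ iT) ⊗ iT)
          ∎

      via-naturality : absorb (𝐏 ∷ 𝐓 ∷ []) ∙ (th ⊗ ι PT) ≋ normal
      via-naturality = begin
        absorb (𝐏 ∷ 𝐓 ∷ []) ∙ (th ⊗ ι PT)
          ≈⟨ ∙-respˡ (th ⊗ ι PT) (≋.trans (absorb-pair 𝐏 𝐓)
               (∙-respʳ (step 𝐏) (ι-⊗-∙ [ 𝐏 ] (th ⊗ iT) (iP ⊗ mT)))) ⟩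
        ((mP ⊗ iT) ∙ (iP ⊗ (iP ⊗ mT)) ∙ (iP ⊗ (th ⊗ iT))) ∙ (th ⊗ ι PT)
          ≈⟨ ∙-assoc (mP ⊗ iT) _ (th ⊗ ι PT) ⟩
        (mP ⊗ iT) ∙ ((iP ⊗ (iP ⊗ mT)) ∙ (iP ⊗ (th ⊗ iT))) ∙ (th ⊗ ι PT)
          ≈⟨ ∙-respʳ (mP ⊗ iT) (∙-assoc (iP ⊗ (iP ⊗ mT)) (iP ⊗ (th ⊗ iT)) (th ⊗ ι PT)) ⟩
        (mP ⊗ iT) ∙ (iP ⊗ (iP ⊗ mT)) ∙ (iP ⊗ (th ⊗ iT)) ∙ (th ⊗ ι PT)
          ≈⟨ ∙-assoc (mP ⊗ iT) (iP ⊗ (iP ⊗ mT)) _ ⟨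
        ((mP ⊗ iT) ∙ (iP ⊗ (iP ⊗ mT))) ∙ (iP ⊗ (th ⊗ iT)) ∙ (th ⊗ ι PT)
          ≈⟨ ∙-resp μP-slides-past-μT
               (≋.trans (∙-respˡ (th ⊗ ι PT) (~⇒≋ (~-sym (⊗-assoc~ iP th iT))))
                        (∙-respʳ ((iP ⊗ th) ⊗ iT) (~⇒≋ (⊗-ιPT~ th)))) ⟩
        ((iP ⊗ mT) ∙ ((mP ⊗ iT) ⊗ iT)) ∙ ((iP ⊗ th) ⊗ iT) ∙ ((th ⊗ iP) ⊗ iT)
          ≈⟨ ∙-assoc (iP ⊗ mT) ((mP ⊗ iT) ⊗ iT) _ ⟩
        normal
          ∎

      via-θ-μP : absorb (𝐓 ∷ 𝐏 ∷ []) ≋ normal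
      via-θ-μP = begin
        absorb (𝐓 ∷ 𝐏 ∷ [])
          ≈⟨ absorb-pair 𝐓 𝐏 ⟩
        ((iP ⊗ mT) ∙ (th ⊗ iT)) ∙ (iT ⊗ (mP ⊗ iT))
          ≈⟨ ∙-assoc (iP ⊗ mT) (th ⊗ iT) (iT ⊗ (mP ⊗ iT)) ⟩
        (iP ⊗ mT) ∙ (th ⊗ iT) ∙ (iT ⊗ (mP ⊗ iT))
          ≈⟨ ∙-respʳ (iP ⊗ mT) (∙-respʳ (th ⊗ iT) (~⇒≋ (~-sym (⊗-assoc~ iT mP iT)))) ⟩
        (iP ⊗ mT) ∙ (th ⊗ iT) ∙ ((iT ⊗ mP) ⊗ iT)
          ≈⟨ ∙-respʳ (iP ⊗ mT) (∙-⊗-ι [ 𝐓 ] (iT ⊗ mP) th) ⟨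
        (iP ⊗ mT) ∙ ((th ∙ (iT ⊗ mP)) ⊗ iT)
          ≈⟨ ∙-respʳ (iP ⊗ mT) (⊗-respˡ iT θ-μP) ⟩
        (iP ⊗ mT) ∙ (((mP ⊗ iT) ∙ (iP ⊗ th) ∙ (th ⊗ iP)) ⊗ iT)
          ≈⟨ ∙-respʳ (iP ⊗ mT) (≋.trans (∙-⊗-ι [ 𝐓 ] ((iP ⊗ th) ∙ (th ⊗ iP)) (mP ⊗ iT))
               (∙-respʳ ((mP ⊗ iT) ⊗ iT) (∙-⊗-ι [ 𝐓 ] (th ⊗ iP) (iP ⊗ th)))) ⟩
        normal
          ∎

    compatible : ∀ {U V} (r : Rule U V) → Compatible (rule r)
    compatible rμP = compatible-μP
    compatible rηP = compatible-ηP
    compatible rμT = compatible-μT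
    compatible rηT = compatible-ηT
    compatible rθ  = compatible-θ

    -- can PT = μᴾT ∘ P(Pμᵀ ∘ θT ∘ Tηᴾηᵀ) reduces to id by θ ∘ Tηᴾ = ηᴾT
    -- and the right unit laws of μᵀ and μᴾ
    can-PT : can PT ≋ ι PT
    can-PT = begin
      step 𝐏 ∙ (iP ⊗ (step 𝐓 ∙ (iT ⊗ (eP ⊗ eT))))
        ≈⟨ ∙-respʳ (step 𝐏) (⊗-respʳ iP absorb-unit) ⟩
      (mP ⊗ iT) ∙ (iP ⊗ (eP ⊗ iT))
        ≈⟨ ∙-respʳ (mP ⊗ iT) (~⇒≋ (~-sym (⊗-assoc~ iP eP iT))) ⟩
      (mP ⊗ iT) ∙ ((iP ⊗ eP) ⊗ iT)
        ≈⟨ ∙-⊗-ι [ 𝐓 ] (iP ⊗ eP) mP ⟨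
      (mP ∙ (iP ⊗ eP)) ⊗ iT
        ≈⟨ ⊗-respˡ iT μP-ηP-right ⟩
      iP ⊗ iT
        ≈⟨ ι⊗ι [ 𝐏 ] [ 𝐓 ] ⟩
      ι PT
        ∎
      where
      absorb-unit : step 𝐓 ∙ (iT ⊗ (eP ⊗ eT)) ≋ eP ⊗ iT
      absorb-unit = begin
        ((iP ⊗ mT) ∙ (th ⊗ iT)) ∙ (iT ⊗ (eP ⊗ eT))
          ≈⟨ ∙-assoc (iP ⊗ mT) (th ⊗ iT) (iT ⊗ (eP ⊗ eT)) ⟩
        (iP ⊗ mT) ∙ (th ⊗ iT) ∙ (iT ⊗ (eP ⊗ eT))
          ≈⟨ ∙-respʳ (iP ⊗ mT) (∙-respʳ (th ⊗ iT) (~⇒≋ (~-sym (⊗-assoc~ iT eP eT)))) ⟩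
        (iP ⊗ mT) ∙ (th ⊗ iT) ∙ ((iT ⊗ eP) ⊗ eT)
          ≈⟨ ∙-respʳ (iP ⊗ mT) (⊗-interchange (iT ⊗ eP) th eT iT) ⟨
        (iP ⊗ mT) ∙ ((th ∙ (iT ⊗ eP)) ⊗ (iT ∙ eT))
          ≈⟨ ∙-respʳ (iP ⊗ mT) (⊗-resp θ-ηP (ι-∙ eT)) ⟩
        (iP ⊗ mT) ∙ ((eP ⊗ iT) ⊗ eT)
          ≈⟨ ∙-respʳ (iP ⊗ mT) (~⇒≋ (⊗-assoc~ eP iT eT)) ⟩
        (iP ⊗ mT) ∙ (eP ⊗ (iT ⊗ eT))
          ≈⟨ ⊗-interchange eP iP (iT ⊗ eT) mT ⟨
        (iP ∙ eP) ⊗ (mT ∙ (iT ⊗ eT))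
          ≈⟨ ⊗-resp (ι-∙ eP) μT-ηT-right ⟩
        eP ⊗ iT
          ∎

  under : ∀ x {w w'} → Derivation w w' → Derivation (x ∷ w) (x ∷ w')
  under x = gmap (x ∷_) (λ { (reduce A r B) → reduce (x ∷ A) r B })

  normalise : ∀ w → Derivation w PT
  normalise []      = reduce [] rηP [] ◅ reduce [ 𝐏 ] rηT [] ◅ ε
  normalise (𝐏 ∷ w) = under 𝐏 (normalise w) ◅◅ reduce [] rμP [ 𝐓 ] ◅ ε
  normalise (𝐓 ∷ w) = under 𝐓 (normalise w) ◅◅ reduce [] rθ [ 𝐓 ] ◅ reduce [ 𝐏 ] rμT [] ◅ ε

  terminal : IsMonad P μP ηP → IsMonad T μT ηT → IsDistributiveLawʷ → PT-Terminal
  terminal monadP monadT dist X = normalise X , λ δ δ' →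
    un (≋.trans (value-canonical compatible can-PT δ) (≋.sym (value-canonical compatible can-PT δ')))
    where open Compatibility monadP monadT dist

  reduction-at-start : ∀ {U V} (r : Rule U V) B → reduction (reduce [] r B) ≋ rule r ⊗ ι B
  reduction-at-start r B = ≋.trans (reduction-whisker [] r B) (ι[]-⊗ (rule r ⊗ ι B))

  reduction-at-end~ : ∀ A {U V} (r : Rule U V) → ap (reduction (reduce A r [])) ~ ap (ι A ⊗ rule r)
  reduction-at-end~ A r = ~-trans (~-trans (reduction~ A r []) (~-∘ₕ ~-refl ∘ₕ-identityʳ~))
                                  (~-sym (⊗~∘ₕ (ι A) (rule r)))

  reduction-alone~ : ∀ {U V} (r : Rule U V) → ap (reduction (reduce [] r [])) ~ ap (rule r)
  reduction-alone~ r = ~-trans (reduction-at-end~ [] r) (≋⇒~ (ι[]-⊗ (rule r)))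

  valueʷ-two : ∀ {X Y Z} (ρ₁ : Reduction X Y) (ρ₂ : Reduction Y Z) →
               valueʷ (ρ₁ ◅ ρ₂ ◅ ε) ≋ reduction ρ₂ ∙ reduction ρ₁
  valueʷ-two ρ₁ ρ₂ = ∙-respˡ (reduction ρ₁) (ι-∙ (reduction ρ₂))

  valueʷ-three : ∀ {W X Y Z} (ρ₁ : Reduction W X) (ρ₂ : Reduction X Y) (ρ₃ : Reduction Y Z) →
                 valueʷ (ρ₁ ◅ ρ₂ ◅ ρ₃ ◅ ε) ≋ reduction ρ₃ ∙ reduction ρ₂ ∙ reduction ρ₁
  valueʷ-three ρ₁ ρ₂ ρ₃ =
    ≋.trans (∙-respˡ (reduction ρ₁) (valueʷ-two ρ₂ ρ₃))
            (∙-assoc (reduction ρ₃) (reduction ρ₂) (reduction ρ₁))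

  module FromTerminality (terminal : PT-Terminal) where
    coherent : ∀ {X} {a b : Hom X PT} (δ δ' : Derivation X PT) →
               valueʷ δ ≋ a → valueʷ δ' ≋ b → a ≋ b
    coherent {X} δ δ' δ≋a δ'≋b =
      ≋.trans (≋.sym δ≋a) (≋.trans (≋i (proj₂ (terminal X) δ δ')) δ'≋b)

    θ-μP : th ∙ (iT ⊗ mP) ≋ (mP ⊗ iT) ∙ (iP ⊗ th) ∙ (th ⊗ iP)
    θ-μP = coherent (ρ₁ ◅ ρ₂ ◅ ε) (ρ₁' ◅ ρ₂' ◅ ρ₃' ◅ ε)
      (≋.trans (valueʷ-two ρ₁ ρ₂)
               (∙-resp {Y = 𝐓 ∷ 𝐏 ∷ []} (~⇒≋ (reduction-alone~ rθ))
                                         (~⇒≋ (reduction-at-end~ [ 𝐓 ] rμP))))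
      (≋.trans (valueʷ-three ρ₁' ρ₂' ρ₃')
               (∙-resp (reduction-at-start rμP [ 𝐓 ])
                       (∙-resp (~⇒≋ (reduction-at-end~ [ 𝐏 ] rθ)) (reduction-at-start rθ [ 𝐏 ]))))
      where
      ρ₁  : Reduction (𝐓 ∷ 𝐏 ∷ 𝐏 ∷ []) (𝐓 ∷ 𝐏 ∷ [])
      ρ₁  = reduce [ 𝐓 ] rμP []
      ρ₂  : Reduction (𝐓 ∷ 𝐏 ∷ []) PT
      ρ₂  = reduce [] rθ []
      ρ₁' : Reduction (𝐓 ∷ 𝐏 ∷ 𝐏 ∷ []) (𝐏 ∷ 𝐓 ∷ 𝐏 ∷ [])
      ρ₁' = reduce [] rθ [ 𝐏 ]
      ρ₂' : Reduction (𝐏 ∷ 𝐓 ∷ 𝐏 ∷ []) (𝐏 ∷ 𝐏 ∷ 𝐓 ∷ [])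
      ρ₂' = reduce [ 𝐏 ] rθ []
      ρ₃' : Reduction (𝐏 ∷ 𝐏 ∷ 𝐓 ∷ []) PT
      ρ₃' = reduce [] rμP [ 𝐓 ]

    θ-μT : th ∙ (mT ⊗ iP) ≋ (iP ⊗ mT) ∙ (th ⊗ iT) ∙ (iT ⊗ th)
    θ-μT = coherent (ρ₁ ◅ ρ₂ ◅ ε) (ρ₁' ◅ ρ₂' ◅ ρ₃' ◅ ε)
      (≋.trans (valueʷ-two ρ₁ ρ₂)
               (∙-resp (~⇒≋ (reduction-alone~ rθ)) (reduction-at-start rμT [ 𝐏 ])))
      (≋.trans (valueʷ-three ρ₁' ρ₂' ρ₃')
               (∙-resp (~⇒≋ (reduction-at-end~ [ 𝐏 ] rμT))
                       (∙-resp (reduction-at-start rθ [ 𝐓 ]) (~⇒≋ (reduction-at-end~ [ 𝐓 ] rθ)))))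
      where
      ρ₁  : Reduction (𝐓 ∷ 𝐓 ∷ 𝐏 ∷ []) (𝐓 ∷ 𝐏 ∷ [])
      ρ₁  = reduce [] rμT [ 𝐏 ]
      ρ₂  : Reduction (𝐓 ∷ 𝐏 ∷ []) PT
      ρ₂  = reduce [] rθ []
      ρ₁' : Reduction (𝐓 ∷ 𝐓 ∷ 𝐏 ∷ []) (𝐓 ∷ 𝐏 ∷ 𝐓 ∷ [])
      ρ₁' = reduce [ 𝐓 ] rθ []
      ρ₂' : Reduction (𝐓 ∷ 𝐏 ∷ 𝐓 ∷ []) (𝐏 ∷ 𝐓 ∷ 𝐓 ∷ [])
      ρ₂' = reduce [] rθ [ 𝐓 ]
      ρ₃' : Reduction (𝐏 ∷ 𝐓 ∷ 𝐓 ∷ []) PT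
      ρ₃' = reduce [ 𝐏 ] rμT []

    θ-ηP : th ∙ (iT ⊗ eP) ≋ eP ⊗ iT
    θ-ηP = coherent (ρ₁ ◅ ρ₂ ◅ ε) (ρ' ◅ ε)
      (≋.trans (valueʷ-two ρ₁ ρ₂)
               (∙-resp {Y = 𝐓 ∷ 𝐏 ∷ []} (~⇒≋ (reduction-alone~ rθ))
                                         (~⇒≋ (reduction-at-end~ [ 𝐓 ] rηP))))
      (≋.trans (ι-∙ (reduction ρ')) (reduction-at-start rηP [ 𝐓 ]))
      where
      ρ₁ : Reduction [ 𝐓 ] (𝐓 ∷ 𝐏 ∷ [])
      ρ₁ = reduce [ 𝐓 ] rηP []
      ρ₂ : Reduction (𝐓 ∷ 𝐏 ∷ []) PT
      ρ₂ = reduce [] rθ []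
      ρ' : Reduction [ 𝐓 ] PT
      ρ' = reduce [] rηP [ 𝐓 ]

    θ-ηT : th ∙ (eT ⊗ iP) ≋ iP ⊗ eT
    θ-ηT = coherent (ρ₁ ◅ ρ₂ ◅ ε) (ρ' ◅ ε)
      (≋.trans (valueʷ-two ρ₁ ρ₂)
               (∙-resp (~⇒≋ (reduction-alone~ rθ)) (reduction-at-start rηT [ 𝐏 ])))
      (≋.trans (ι-∙ (reduction ρ')) (~⇒≋ (reduction-at-end~ [ 𝐏 ] rηT)))
      where
      ρ₁ : Reduction [ 𝐏 ] (𝐓 ∷ 𝐏 ∷ [])
      ρ₁ = reduce [] rηT [ 𝐏 ]
      ρ₂ : Reduction (𝐓 ∷ 𝐏 ∷ []) PT
      ρ₂ = reduce [] rθ []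
      ρ' : Reduction [ 𝐏 ] PT
      ρ' = reduce [ 𝐏 ] rηT []

    laws : IsDistributiveLawʷ
    laws = record { θ-μP = θ-μP ; θ-μT = θ-μT ; θ-ηP = θ-ηP ; θ-ηT = θ-ηT }

lemma4p4 : ∀ {o ℓ₁ ℓ₂ e} (K : TwoCategory o ℓ₁ ℓ₂ e) (𝒞 : TwoCategory.Obj K)
           (P T : TwoCategory._⇒₁_ K 𝒞 𝒞)
           (μP : TwoCategory._⇒₂_ K (TwoCategory._⊙_ K P P) P)
           (ηP : TwoCategory._⇒₂_ K (TwoCategory.id₁ K) P)
           (μT : TwoCategory._⇒₂_ K (TwoCategory._⊙_ K T T) T)
           (ηT : TwoCategory._⇒₂_ K (TwoCategory.id₁ K) T)
           (θ : TwoCategory._⇒₂_ K (TwoCategory._⊙_ K T P) (TwoCategory._⊙_ K P T)) →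
           Setup.IsMonad K 𝒞 P μP ηP →
           Setup.IsMonad K 𝒞 T μT ηT →
           (Setup.Data.IsDistributiveLaw K 𝒞 P T μP ηP μT ηT θ
             ⇔ Setup.Data.PT-Terminal K 𝒞 P T μP ηP μT ηT θ)
lemma4p4 K 𝒞 P T μP ηP μT ηT θ monadP monadT = mk⇔
  (λ law → terminal monadP monadT (Equivalence.to distributiveLaw⇔ʷ law))
  (λ pt  → Equivalence.from distributiveLaw⇔ʷ (FromTerminality.laws pt))
  where open Coherence K 𝒞 P T μP ηP μT ηT θ
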